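{- Let $(\mathbf{C}, \mathbf{C}_{\mathrm{free}})$ be a partitioned process theory. Then the ordered monoid $(\lvert \mathrm{PCD}(\mathbf{C},\mathbf{C}_{\mathrm{free}})\rvert, \succeq, \otimes)$ is non-negative.
   Context: A partitioned process theory $(\mathbf{C}, \mathbf{C}_{\mathrm{free}})$ consists of a (small) symmetric monoidal category $\mathbf{C}$ together with a wide (all-object-including) symmetric monoidal subcategory $\mathbf{C}_{\mathrm{free}}$; morphisms of $\mathbf{C}$ are called processes and morphisms of $\mathbf{C}_{\mathrm{free}}$ free processes. The resource theory of parallel-combinable processes with discarding $\mathrm{PCD}(\mathbf{C},\mathbf{C}_{\mathrm{free}})$ is the symmetric monoidal category whose objects are the morphisms $f$ of $\mathbf{C}$, and whose morphisms $f \to g$ are triples $(Z,\xi_1,\xi_2)$ with $Z$ an object of $\mathbf{C}$ and $\xi_1,\xi_2$ morphisms of $\mathbf{C}_{\mathrm{free}}$ such that there exists a morphism $j$ of $\mathbf{C}$ with $\xi_2 \circ (f \otimes 1_Z) \circ \xi_1 = g \otimes j$; the monoidal product on objects is the monoidal product $\otimes$ of $\mathbf{C}$. For a symmetric monoidal category $\mathbf{R}$, objects $f,g$ are called equivalent if there are morphisms $f\to g$ and $g \to f$; $\lvert\mathbf{R}\rvert$ denotes the set of equivalence classes $[f]$, which forms a commutative ordered monoid $(\lvert\mathbf{R}\rvert,\succeq,\otimes)$ with $[f]\succeq[g]$ iff there is a morphism $f\to g$ in $\mathbf{R}$ and $[f]\otimes[g]=[f\otimes g]$, the unit being the class of the monoidal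 unit. An ordered monoid (a set with a partial order and a monoid multiplication such that $x \succeq y$ and $z \succeq w$ imply $x\cdot z \succeq y\cdot w$) is called non-negative if its identity element $1$ is the bottom element, i.e. $x \succeq 1$ for all $x$. In $\lvert \mathrm{PCD}(\mathbf{C},\mathbf{C}_{\mathrm{free}})\rvert$ the free morphisms form one equivalence class, which contains all identities $1_X$ and is the monoid identity, written $1$. -}

module Defs where

open import Level using (Level; _⊔_; suc)
open import Relation.Binary.PropositionalEquality using (_≡_)
open import Data.Product using (Σ; ∃; ∃-syntax; _×_; _,_; proj₁; proj₂)

record SymMonCat (o ℓ : Level) : Set (Level.suc (o ⊔ ℓ)) where
  infixr 9 _∘_
  infixr 10 _⊗₀_ _⊗₁_
  field
    Obj  : Set o
    Hom  : Obj → Obj → Set ℓ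
    id   : ∀ {A} → Hom A A
    _∘_  : ∀ {A B C} → Hom B C → Hom A B → Hom A C
    identityˡ : ∀ {A B} (f : Hom A B) → id ∘ f ≡ f
    identityʳ : ∀ {A B} (f : Hom A B) → f ∘ id ≡ f
    assoc     : ∀ {A B C D} (f : Hom A B) (g : Hom B C) (h : Hom C D) →
                (h ∘ g) ∘ f ≡ h ∘ (g ∘ f)

    _⊗₀_ : Obj → Obj → Obj
    _⊗₁_ : ∀ {A B C D} → Hom A B → Hom C D → Hom (A ⊗₀ C) (B ⊗₀ D)
    ⊗-id : ∀ {A B} → (id {A}) ⊗₁ (id {B}) ≡ id
    ⊗-∘  : ∀ {A B C D E F} (f : Hom A B) (g : Hom B C) (h : Hom D E) (k : Hom E F) →
           (g ∘ f) ⊗₁ (k ∘ h) ≡ (g ⊗₁ k) ∘ (f ⊗₁ h)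
    unit : Obj

    α   : ∀ {A B C} → Hom ((A ⊗₀ B) ⊗₀ C) (A ⊗₀ (B ⊗₀ C))
    α⁻¹ : ∀ {A B C} → Hom (A ⊗₀ (B ⊗₀ C)) ((A ⊗₀ B) ⊗₀ C)
    λ⇒  : ∀ {A} → Hom (unit ⊗₀ A) A
    λ⇐  : ∀ {A} → Hom A (unit ⊗₀ A)
    ρ⇒  : ∀ {A} → Hom (A ⊗₀ unit) A
    ρ⇐  : ∀ {A} → Hom A (A ⊗₀ unit)
    σ   : ∀ {A B} → Hom (A ⊗₀ B) (B ⊗₀ A)

    α-isoˡ : ∀ {A B C} → α⁻¹ {A} {B} {C} ∘ α ≡ id
    α-isoʳ : ∀ {A B C} → α {A} {B} {C} ∘ α⁻¹ ≡ id
    λ-isoˡ : ∀ {A} → λ⇐ {A} ∘ λ⇒ ≡ id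
    λ-isoʳ : ∀ {A} → λ⇒ {A} ∘ λ⇐ ≡ id
    ρ-isoˡ : ∀ {A} → ρ⇐ {A} ∘ ρ⇒ ≡ id
    ρ-isoʳ : ∀ {A} → ρ⇒ {A} ∘ ρ⇐ ≡ id
    σ-inv  : ∀ {A B} → σ {B} {A} ∘ σ {A} {B} ≡ id

    α-natural : ∀ {A A' B B' C C'} (f : Hom A A') (g : Hom B B') (h : Hom C C') →
                α ∘ ((f ⊗₁ g) ⊗₁ h) ≡ (f ⊗₁ (g ⊗₁ h)) ∘ α
    λ-natural : ∀ {A B} (f : Hom A B) → λ⇒ ∘ (id {unit} ⊗₁ f) ≡ f ∘ λ⇒
    ρ-natural : ∀ {A B} (f : Hom A B) → ρ⇒ ∘ (f ⊗₁ id {unit}) ≡ f ∘ ρ⇒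
    σ-natural : ∀ {A A' B B'} (f : Hom A A') (g : Hom B B') →
                σ ∘ (f ⊗₁ g) ≡ (g ⊗₁ f) ∘ σ

    pentagon : ∀ {A B C D} →
               (id {A} ⊗₁ α {B} {C} {D}) ∘ α ∘ (α ⊗₁ id {D}) ≡ α ∘ α
    triangle : ∀ {A B} → (id {A} ⊗₁ λ⇒ {B}) ∘ α ≡ ρ⇒ ⊗₁ id {B}
    hexagon  : ∀ {A B C} →
               (id {B} ⊗₁ σ {A} {C}) ∘ α ∘ (σ {A} {B} ⊗₁ id {C})
                 ≡ α ∘ σ {A} {B ⊗₀ C} ∘ α

record WideSymMonSub {o ℓ : Level} (C : SymMonCat o ℓ) (p : Level)
       : Set (o ⊔ ℓ ⊔ Level.suc p) where
  open SymMonCat C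
  field
    Free     : ∀ {A B} → Hom A B → Set p
    free-id  : ∀ {A} → Free (id {A})
    free-∘   : ∀ {A B D} {f : Hom A B} {g : Hom B D} → Free f → Free g → Free (g ∘ f)
    free-⊗   : ∀ {A B D E} {f : Hom A B} {g : Hom D E} → Free f → Free g → Free (f ⊗₁ g)
    free-α   : ∀ {A B D} → Free (α {A} {B} {D})
    free-α⁻¹ : ∀ {A B D} → Free (α⁻¹ {A} {B} {D})
    free-λ⇒  : ∀ {A} → Free (λ⇒ {A})
    free-λ⇐  : ∀ {A} → Free (λ⇐ {A})
    free-ρ⇒  : ∀ {A} → Free (ρ⇒ {A})
    free-ρ⇐  : ∀ {A} → Free (ρ⇐ {A})
    free-σ   : ∀ {A B} → Free (σ {A} {B})

record PartitionedProcessTheory (o ℓ p : Level) : Set (Level.suc (o ⊔ ℓ ⊔ p)) where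
  field
    C     : SymMonCat o ℓ
    Cfree : WideSymMonSub C p

module PCD {o ℓ p} (T : PartitionedProcessTheory o ℓ p) where
  open PartitionedProcessTheory T
  open SymMonCat C
  open WideSymMonSub Cfree

  Process : Set (o ⊔ ℓ)
  Process = Σ Obj λ A → Σ Obj λ B → Hom A B

  -- morphisms f → g of PCD: triples (Z, ξ₁, ξ₂) with ξ₁, ξ₂ free such that
  -- ξ₂ ∘ (f ⊗ 1_Z) ∘ ξ₁ = g ⊗ j for some morphism j of C.
  -- (The domain/codomain of ξ₁, ξ₂ are forced by this equation to be
  --  X ⊗ W → A ⊗ Z and B ⊗ Z → Y ⊗ W' where g : X → Y, j : W → W'.)
  record PCDHom (f g : Process) : Set (o ⊔ ℓ ⊔ p) where
    constructor pcdHom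
    field
      Z  : Obj
      W  : Obj
      W' : Obj
      ξ₁ : Hom (proj₁ g ⊗₀ W) (proj₁ f ⊗₀ Z)
      ξ₂ : Hom (proj₁ (proj₂ f) ⊗₀ Z) (proj₁ (proj₂ g) ⊗₀ W')
      ξ₁-free : Free ξ₁
      ξ₂-free : Free ξ₂
      j  : Hom W W'
      eq : ξ₂ ∘ (proj₂ (proj₂ f) ⊗₁ id {Z}) ∘ ξ₁ ≡ proj₂ (proj₂ g) ⊗₁ j

  _⪰_ : Process → Process → Set (o ⊔ ℓ ⊔ p)
  f ⪰ g = PCDHom f g

  𝟙 : Process
  𝟙 = unit , unit , id {unit}

-- (|PCD(C,C_free)|, ⪰, ⊗) is non-negative: every element is ⪰ the identity.
-- (The order on equivalence classes is defined via representatives, so this is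
--  stated on representatives.)
NonNegativePCD : ∀ {o ℓ p} → PartitionedProcessTheory o ℓ p → Set (o ⊔ ℓ ⊔ p)
NonNegativePCD T = ∀ (f : Process) → f ⪰ 𝟙
  where open PCD T

module Submission where

open import Defs
open import Level using (Level)
open import Data.Product using (_,_)
open import Relation.Binary.PropositionalEquality using (_≡_; sym; cong; module ≡-Reasoning)

-- Every process f is converted into the identity of the unit by tensoring it
-- with 1_I, swapping the two factors, and regarding f as the discarded part j.

module _ {o ℓ} (C : SymMonCat o ℓ) where
  open SymMonCat C
  open ≡-Reasoning

  σ-conjugate-⊗ : ∀ {A A' B B'} (f : Hom A A') (g : Hom B B') →
                  σ ∘ (f ⊗₁ g) ∘ σ ≡ g ⊗₁ f
  σ-conjugate-⊗ f g = begin
    σ ∘ (f ⊗₁ g) ∘ σ    ≡⟨ sym (assoc σ (f ⊗₁ g) σ) ⟩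
    (σ ∘ (f ⊗₁ g)) ∘ σ  ≡⟨ cong (_∘ σ) (σ-natural f g) ⟩
    ((g ⊗₁ f) ∘ σ) ∘ σ  ≡⟨ assoc σ σ (g ⊗₁ f) ⟩
    (g ⊗₁ f) ∘ (σ ∘ σ)  ≡⟨ cong ((g ⊗₁ f) ∘_) σ-inv ⟩
    (g ⊗₁ f) ∘ id       ≡⟨ identityʳ (g ⊗₁ f) ⟩
    g ⊗₁ f              ∎

lemma2p5 : ∀ {o ℓ p : Level} (T : PartitionedProcessTheory o ℓ p) → NonNegativePCD T
lemma2p5 T (A , B , f) =
  PCD.pcdHom unit A B σ σ free-σ free-σ f (σ-conjugate-⊗ C f id)
  where
  open PartitionedProcessTheory T
  open SymMonCat C using (unit; id; σ)
  open WideSymMonSub Cfree using (free-σ)
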